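{- Let $M$ be an $n$-quasi-paving matroid of rank $n$. Then $M$ is obtained from a tame paving matroid of rank $n$ by a finite sequence of principal extensions, each along a flat of rank $n-2$ (of the matroid being extended).
   Context: Given subsets $H_1,\ldots,H_k$ of $[d]$ with any three having empty intersection and a positive integer $n$, the $n$-quasi-paving matroid they define is the matroid on $[d]$ whose circuits are: the $(n-1)$-subsets contained in $H_i\cap H_j$ for some $i\ne j$ (Type 1); the $n$-subsets contained in some $H_i$ containing no Type 1 set (Type 2); the $(n+1)$-subsets containing no Type 1 or Type 2 set (Type 3). A paving matroid of rank $n$ has all circuits of size $n$ or $n+1$; its dependent hyperplanes are the maximal sets of size $\ge n$ all of whose $n$-subsets are circuits; it is tame if any three distinct dependent hyperplanes have empty intersection. Principal extension: for a matroid $M'$ on $E'$, a flat $F$ of $M'$ and a new element $a$, $M'+_Fa$ is the matroid on $E'\cup\{a\}$ with bases $\mathcal{B}(M')\cup\{(\lambda\setminus\{b\})\cup\{a\}:\lambda\in\mathcal{B}(M'),\ b\in\lambda\cap F\}$. -}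

module Defs where

open import Data.Nat using (ℕ; suc; _+_; _≤_; _<_)
open import Data.Fin using (Fin)
open import Data.Fin.Subset
  using (Subset; _∈_; _∉_; _⊆_; _∩_; _∪_; _-_; ⁅_⁆; ∣_∣; ⊤)
  renaming (⊥ to ∅)
open import Data.Product using (Σ; ∃; ∃-syntax; _×_; _,_)
open import Data.Sum using (_⊎_)
open import Relation.Nullary using (¬_)
open import Relation.Binary.PropositionalEquality using (_≡_; _≢_)
open import Function.Bundles using (_⇔_)

record PreMatroid (d : ℕ) : Set₁ where
  field
    ground  : Subset d
    isBasis : Subset d → Set
open PreMatroid public

record IsMatroid {d : ℕ} (M : PreMatroid d) : Set where
  field
    basis-exists : ∃[ B ] isBasis M B
    basis-ground : ∀ B → isBasis M B → B ⊆ ground M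
    exchange     : ∀ B₁ B₂ x → isBasis M B₁ → isBasis M B₂ → x ∈ B₁ → x ∉ B₂ →
                   ∃[ y ] (y ∈ B₂ × y ∉ B₁ × isBasis M ((B₁ - x) ∪ ⁅ y ⁆))

module _ {d : ℕ} (M : PreMatroid d) where

  Independent : Subset d → Set
  Independent X = ∃[ B ] (isBasis M B × X ⊆ B)

  Dependent : Subset d → Set
  Dependent X = X ⊆ ground M × ¬ Independent X

  Circuit : Subset d → Set
  Circuit C = Dependent C × (∀ Y → Y ⊆ C → Y ≢ C → Independent Y)

  HasRank : Subset d → ℕ → Set
  HasRank X r = (∃[ I ] (I ⊆ X × Independent I × ∣ I ∣ ≡ r))
              × (∀ I → I ⊆ X → Independent I → ∣ I ∣ ≤ r)

  MatroidRank : ℕ → Set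
  MatroidRank r = HasRank (ground M) r

  Flat : Subset d → Set
  Flat F = F ⊆ ground M ×
           (∀ e → e ∈ ground M → e ∉ F → ∀ r s →
              HasRank F r → HasRank (F ∪ ⁅ e ⁆) s → r < s)

  IsPaving : ℕ → Set
  IsPaving n = IsMatroid M × MatroidRank n ×
               (∀ C → Circuit C → ∣ C ∣ ≡ n ⊎ ∣ C ∣ ≡ suc n)

  AllNSubsetsCircuits : ℕ → Subset d → Set
  AllNSubsetsCircuits n S = S ⊆ ground M × n ≤ ∣ S ∣ ×
                            (∀ X → X ⊆ S → ∣ X ∣ ≡ n → Circuit X)

  DependentHyperplane : ℕ → Subset d → Set
  DependentHyperplane n S = AllNSubsetsCircuits n S ×
                            (∀ T → S ⊆ T → AllNSubsetsCircuits n T → T ≡ S)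

  IsTame : ℕ → Set
  IsTame n = ∀ S₁ S₂ S₃ → DependentHyperplane n S₁ → DependentHyperplane n S₂ →
             DependentHyperplane n S₃ → S₁ ≢ S₂ → S₁ ≢ S₃ → S₂ ≢ S₃ →
             S₁ ∩ S₂ ∩ S₃ ≡ ∅

principalExtension : {d : ℕ} → PreMatroid d → Subset d → Fin d → PreMatroid d
principalExtension M F a = record
  { ground  = ground M ∪ ⁅ a ⁆
  ; isBasis = λ X → isBasis M X ⊎
      (∃[ L ] ∃[ b ] (isBasis M L × b ∈ L × b ∈ F × X ≡ (L - b) ∪ ⁅ a ⁆))
  }

SameMatroid : {d : ℕ} → PreMatroid d → PreMatroid d → Set
SameMatroid M N = ground M ≡ ground N × (∀ X → isBasis M X ⇔ isBasis N X)

data ExtSeq {d : ℕ} (n : ℕ) : PreMatroid d → PreMatroid d → Set₁ where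
  done : ∀ {N M} → SameMatroid N M → ExtSeq n N M
  step : ∀ {N M} (F : Subset d) (a : Fin d) (r : ℕ) →
         a ∉ ground N → Flat N F → HasRank N F r → r + 2 ≡ n →
         ExtSeq n (principalExtension N F a) M → ExtSeq n N M

module _ {d k : ℕ} (n : ℕ) (H : Fin k → Subset d) where

  Type1 : Subset d → Set
  Type1 X = suc ∣ X ∣ ≡ n × ∃[ i ] ∃[ j ] (i ≢ j × X ⊆ H i ∩ H j)

  Type2 : Subset d → Set
  Type2 X = ∣ X ∣ ≡ n × (∃[ i ] X ⊆ H i) × ¬ (∃[ Y ] (Y ⊆ X × Type1 Y))

  Type3 : Subset d → Set
  Type3 X = ∣ X ∣ ≡ suc n × ¬ (∃[ Y ] (Y ⊆ X × (Type1 Y ⊎ Type2 Y)))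

  QPCircuit : Subset d → Set
  QPCircuit X = Type1 X ⊎ Type2 X ⊎ Type3 X

ThreewiseDisjoint : {d k : ℕ} → (Fin k → Subset d) → Set
ThreewiseDisjoint H = ∀ i j l → i ≢ j → i ≢ l → j ≢ l → H i ∩ H j ∩ H l ≡ ∅

IsQuasiPaving : {d : ℕ} → ℕ → PreMatroid d → Set
IsQuasiPaving {d} n M =
  IsMatroid M × 0 < n × ground M ≡ ⊤ ×
  ∃[ k ] Σ (Fin k → Subset d) λ H →
    ThreewiseDisjoint H × (∀ X → Circuit M X ⇔ QPCircuit n H X)

-- Enlarge a basis B greedily to a maximal set E ⊇ B containing no Type 1 set.  In M|E only
-- Type 2 and Type 3 circuits remain, so M|E is paving; its dependent hyperplanes are the sets
-- E ∩ H i, hence tame since the H i are threewise disjoint.  Every a ∉ E completes some K ⊆ E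
-- with |K| = n - 2 to a Type 1 set K ∪ {a} ⊆ H i ∩ H j.  Adding a to E is then the principal
-- extension along F = {e ∈ E : K ∪ {e} lies in some H p ∩ H q}, a flat of rank |K|: a basis
-- containing a comes from a basis of M|E by trading a for a point of F, and a point of F in a
-- basis lies in exactly the same sets H l as a, so the trade preserves independence.

{-# OPTIONS --safe #-}
module Submission where

open import Data.Nat using (ℕ; zero; suc; _+_; _≤_; _<_; s≤s; _≟_)
open import Data.Nat.Properties
  using ( ≤-trans; ≤-reflexive; ≤-antisym; <-irrefl; <⇒≱; ≰⇒>; +-comm; n≤1+n; 1+n≰n; 1+n≢n; n<1+n
        ; suc-injective; _≤?_; module ≤-Reasoning)
open import Data.Fin using (Fin; zero; suc)
open import Data.Fin.Properties using (any?) renaming (_≟_ to _≟ᶠ_)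
open import Data.Fin.Subset
  using (Subset; _∈_; _∉_; _⊆_; _⊂_; _⊃_; _∩_; _∪_; _─_; _-_; ⁅_⁆; ∣_∣; ⊤; Nonempty; inside; outside)
  renaming (⊥ to ∅)
open import Data.Fin.Subset.Properties
open import Data.Fin.Subset.Induction using (Acc; acc; ⊂-wellFounded; ⊃-wellFounded)
open import Data.Vec using ([]; _∷_; here; there)
open import Data.Product using (∃; ∃-syntax; _×_; _,_; proj₁; proj₂)
import Data.Product as Product
open import Data.Sum using (_⊎_; inj₁; inj₂)
open import Data.Empty using (⊥-elim)
open import Function using (_∘_; case_of_)
open import Function.Bundles using (_⇔_; mk⇔; Equivalence)
import Function.Properties.Equivalence
open import Relation.Nullary using (¬_; Dec; yes; no; does; ¬?; _×-dec_; _⊎-dec_; contradiction)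
open import Relation.Nullary.Decidable using (decidable-stable; ¬¬-excluded-middle; map′)
open import Relation.Binary.PropositionalEquality
  using (_≡_; _≢_; refl; sym; trans; cong; subst)

open import Defs

private variable
  d : ℕ
  x y : Fin d
  p p′ q q′ s : Subset d

x∈p─q⁻ : ∀ (p q : Subset d) → x ∈ p ─ q → x ∈ p × x ∉ q
x∈p─q⁻ (inside ∷ p)  (outside ∷ q) here = here , λ ()
x∈p─q⁻ {x = zero} (inside ∷ p)  (inside ∷ q)  ()
x∈p─q⁻ {x = zero} (outside ∷ p) (inside ∷ q)  ()
x∈p─q⁻ {x = zero} (outside ∷ p) (outside ∷ q) ()
x∈p─q⁻ (_ ∷ p) (_ ∷ q) (there x∈) = Product.map there (λ x∉q → x∉q ∘ drop-there) (x∈p─q⁻ p q x∈)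

x∈p-y⁻ : x ∈ p - y → x ∈ p × x ≢ y
x∈p-y⁻ {p = p} {y = y} x∈ = Product.map₂ x∉⁅y⁆⇒x≢y (x∈p─q⁻ p ⁅ y ⁆ x∈)

p-x⊆p : p - x ⊆ p
p-x⊆p = proj₁ ∘ x∈p-y⁻

x∈p∪⁅y⁆⁻ : ∀ p → x ∈ p ∪ ⁅ y ⁆ → x ∈ p ⊎ x ≡ y
x∈p∪⁅y⁆⁻ {y = y} p x∈ = Data.Sum.map₂ (x∈⁅y⁆⇒x≡y y) (x∈p∪q⁻ p ⁅ y ⁆ x∈)

y∈p∪⁅y⁆ : y ∈ p ∪ ⁅ y ⁆
y∈p∪⁅y⁆ {y = y} = x∈p∪q⁺ (inj₂ (x∈⁅x⁆ y))

∪⁅⁆-least : p ⊆ s → y ∈ s → p ∪ ⁅ y ⁆ ⊆ s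
∪⁅⁆-least {p = p} p⊆s y∈s x∈ with x∈p∪⁅y⁆⁻ p x∈
... | inj₁ x∈p = p⊆s x∈p
... | inj₂ refl = y∈s

⁅x⁆⊆p : x ∈ p → ⁅ x ⁆ ⊆ p
⁅x⁆⊆p {x = x} {p = p} x∈p y∈ = subst (_∈ p) (sym (x∈⁅y⁆⇒x≡y x y∈)) x∈p

∩-mono : p ⊆ p′ → q ⊆ q′ → p ∩ q ⊆ p′ ∩ q′
∩-mono {p = p} {q = q} p⊆p′ q⊆q′ x∈ = x∈p∩q⁺ (Product.map p⊆p′ q⊆q′ (x∈p∩q⁻ p q x∈))

∪-least : p ⊆ s → q ⊆ s → p ∪ q ⊆ s
∪-least {p = p} {q = q} p⊆s q⊆s x∈ = Data.Sum.[ p⊆s , q⊆s ] (x∈p∪q⁻ p q x∈)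

swap-⊆ : p ⊆ s → y ∈ s → (p - x) ∪ ⁅ y ⁆ ⊆ s
swap-⊆ p⊆s = ∪⁅⁆-least (p⊆s ∘ p-x⊆p)

∈-swap⁺ : ∀ {z} p → z ∈ p ∪ ⁅ y ⁆ → z ≢ x → z ∈ (p - x) ∪ ⁅ y ⁆
∈-swap⁺ p z∈ z≢x with x∈p∪⁅y⁆⁻ p z∈
... | inj₁ z∈p = x∈p∪q⁺ (inj₁ (x∈p∧x≢y⇒x∈p-y z∈p z≢x))
... | inj₂ refl = y∈p∪⁅y⁆

p⊆p-x∪⁅x⁆ : p ⊆ (p - x) ∪ ⁅ x ⁆
p⊆p-x∪⁅x⁆ {x = x} {z} z∈p with z ≟ᶠ x
... | yes refl = y∈p∪⁅y⁆
... | no z≢x   = x∈p∪q⁺ (inj₁ (x∈p∧x≢y⇒x∈p-y z∈p z≢x))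

p⊆q∪⁅x⁆⇒p-x⊆q : p ⊆ q ∪ ⁅ x ⁆ → p - x ⊆ q
p⊆q∪⁅x⁆⇒p-x⊆q {q = q} p⊆q+x z∈ with x∈p-y⁻ z∈
... | z∈p , z≢x with x∈p∪⁅y⁆⁻ q (p⊆q+x z∈p)
...   | inj₁ z∈q = z∈q
...   | inj₂ z≡x = contradiction z≡x z≢x

p⊆q∪⁅x⁆∧x∉p⇒p⊆q : p ⊆ q ∪ ⁅ x ⁆ → x ∉ p → p ⊆ q
p⊆q∪⁅x⁆∧x∉p⇒p⊆q p⊆q+x x∉p z∈p = p⊆q∪⁅x⁆⇒p-x⊆q p⊆q+x (x∈p∧x≢y⇒x∈p-y z∈p λ { refl → x∉p z∈p })

p-x⊆q⇒p⊆q∪⁅x⁆ : p - x ⊆ q → p ⊆ q ∪ ⁅ x ⁆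
p-x⊆q⇒p⊆q∪⁅x⁆ p-x⊆q = ∪⁅⁆-least (p⊆p∪q _ ∘ p-x⊆q) y∈p∪⁅y⁆ ∘ p⊆p-x∪⁅x⁆

⊆-or-∃∉ : ∀ (p q : Subset d) → p ⊆ q ⊎ ∃[ x ] (x ∈ p × x ∉ q)
⊆-or-∃∉ p q with any? (λ x → x ∈? p ×-dec ¬? (x ∈? q))
... | yes ∃x = inj₂ ∃x
... | no ∄x = inj₁ λ {x} x∈p → decidable-stable (x ∈? q) (λ x∉q → ∄x (x , x∈p , x∉q))

⊆∧≢⇒⊂ : p ⊆ q → p ≢ q → p ⊂ q
⊆∧≢⇒⊂ {p = p} {q} p⊆q p≢q with ⊆-or-∃∉ q p
... | inj₁ q⊆p = contradiction (⊆-antisym p⊆q q⊆p) p≢q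
... | inj₂ ∃x = p⊆q , ∃x

⊆∧∣q∣≤∣p∣⇒p≡q : p ⊆ q → ∣ q ∣ ≤ ∣ p ∣ → p ≡ q
⊆∧∣q∣≤∣p∣⇒p≡q {p = p} {q} p⊆q ∣q∣≤∣p∣ with ⊆-or-∃∉ q p
... | inj₁ q⊆p = ⊆-antisym p⊆q q⊆p
... | inj₂ ∃x = contradiction ∣q∣≤∣p∣ (<⇒≱ (p⊂q⇒∣p∣<∣q∣ (p⊆q , ∃x)))

∣p∪⁅y⁆∣≡1+∣p∣ : ∀ p → y ∉ p → ∣ p ∪ ⁅ y ⁆ ∣ ≡ suc ∣ p ∣
∣p∪⁅y⁆∣≡1+∣p∣ {y = zero}  (outside ∷ p) _   = cong (suc ∘ ∣_∣) (∪-identityʳ p)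
∣p∪⁅y⁆∣≡1+∣p∣ {y = zero}  (inside ∷ p)  y∉p = contradiction here y∉p
∣p∪⁅y⁆∣≡1+∣p∣ {y = suc y} (outside ∷ p) y∉p = ∣p∪⁅y⁆∣≡1+∣p∣ p (y∉p ∘ there)
∣p∪⁅y⁆∣≡1+∣p∣ {y = suc y} (inside ∷ p)  y∉p = cong suc (∣p∪⁅y⁆∣≡1+∣p∣ p (y∉p ∘ there))

1+∣p-x∣≡∣p∣ : ∀ p → x ∈ p → suc ∣ p - x ∣ ≡ ∣ p ∣
1+∣p-x∣≡∣p∣ (inside ∷ p)  here       = cong (suc ∘ ∣_∣) (p─⊥≡p p)
1+∣p-x∣≡∣p∣ (outside ∷ p) (there x∈) = 1+∣p-x∣≡∣p∣ p x∈
1+∣p-x∣≡∣p∣ (inside ∷ p)  (there x∈) = cong suc (1+∣p-x∣≡∣p∣ p x∈)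

∣p-x∪⁅y⁆∣≡∣p∣ : x ∈ p → y ∉ p → ∣ (p - x) ∪ ⁅ y ⁆ ∣ ≡ ∣ p ∣
∣p-x∪⁅y⁆∣≡∣p∣ {p = p} x∈p y∉p =
  trans (∣p∪⁅y⁆∣≡1+∣p∣ (p - _) (y∉p ∘ p-x⊆p)) (1+∣p-x∣≡∣p∣ p x∈p)

swap-involutive : x ∈ p → y ∉ p → (((p - x) ∪ ⁅ y ⁆) - y) ∪ ⁅ x ⁆ ≡ p
swap-involutive {x = x} {p} {y} x∈p y∉p =
  ⊆-antisym (∪⁅⁆-least (p-x⊆p ∘ p⊆q∪⁅x⁆⇒p-x⊆q ⊆-refl) x∈p) (p-x⊆q⇒p⊆q∪⁅x⁆ p-x⊆)
  where
  p-x⊆ : p - x ⊆ ((p - x) ∪ ⁅ y ⁆) - y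
  p-x⊆ z∈ = x∈p∧x≢y⇒x∈p-y (p⊆p∪q _ z∈) λ { refl → y∉p (p-x⊆p z∈) }

0<∣p∣⇒nonempty : ∀ (p : Subset d) → 0 < ∣ p ∣ → Nonempty p
0<∣p∣⇒nonempty {d} p 0<∣p∣ = decidable-stable (nonempty? p) λ empty →
  <-irrefl (sym (trans (cong ∣_∣ (Empty-unique empty)) (∣⊥∣≡0 d))) 0<∣p∣

∃-⊆-of-size : ∀ m (p : Subset d) → m ≤ ∣ p ∣ → ∃[ q ] (q ⊆ p × ∣ q ∣ ≡ m)
∃-⊆-of-size {d} zero p _ = ∅ , ⊥⊆ , ∣⊥∣≡0 d
∃-⊆-of-size (suc m) (outside ∷ p) m<∣p∣ =
  Product.map (outside ∷_) (Product.map₁ out⊆) (∃-⊆-of-size (suc m) p m<∣p∣)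
∃-⊆-of-size (suc m) (inside ∷ p) (s≤s m≤∣p∣) =
  Product.map (inside ∷_) (Product.map s⊆s (cong suc)) (∃-⊆-of-size m p m≤∣p∣)

select : {P : Fin d → Set} → (∀ x → Dec (P x)) → Subset d
select {zero}  P? = []
select {suc d} P? = does (P? zero) ∷ select (P? ∘ suc)

∈-select⁺ : {P : Fin d → Set} (P? : ∀ x → Dec (P x)) → P x → x ∈ select P?
∈-select⁺ {x = zero} P? px with P? zero
... | yes _  = here
... | no ¬px = contradiction px ¬px
∈-select⁺ {x = suc x} P? px = there (∈-select⁺ (P? ∘ suc) px)

∈-select⁻ : {P : Fin d → Set} (P? : ∀ x → Dec (P x)) → x ∈ select P? → P x
∈-select⁻ {x = zero} P? x∈ with P? zero
... | yes px = px
... | no _   = case x∈ of λ ()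
∈-select⁻ {x = suc x} P? (there x∈) = ∈-select⁻ (P? ∘ suc) x∈

¬¬-∀-Subset : {P : Subset d → Set} → (∀ Y → ¬ ¬ P Y) → ¬ ¬ (∀ Y → P Y)
¬¬-∀-Subset {zero}  h k = h [] λ P[] → k λ { [] → P[] }
¬¬-∀-Subset {suc d} h k =
  ¬¬-∀-Subset (h ∘ (inside ∷_)) λ P-in →
  ¬¬-∀-Subset (h ∘ (outside ∷_)) λ P-out →
  k λ { (inside ∷ Y) → P-in Y ; (outside ∷ Y) → P-out Y }

module _ {d : ℕ} where

  private variable
    N N′ N″ : PreMatroid d
    X F : Subset d
    a : Fin d
    r n : ℕ

  same-sym : SameMatroid N N′ → SameMatroid N′ N
  same-sym (ground≡ , bases⇔) = sym ground≡ , λ X → Function.Properties.Equivalence.sym (bases⇔ X)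

  same-trans : SameMatroid N N′ → SameMatroid N′ N″ → SameMatroid N N″
  same-trans (ground≡ , bases⇔) (ground≡′ , bases⇔′) =
    trans ground≡ ground≡′ , λ X → Function.Properties.Equivalence.trans (bases⇔ X) (bases⇔′ X)

  independent-cong : SameMatroid N N′ → Independent N X → Independent N′ X
  independent-cong (_ , bases⇔) (B , basisB , X⊆B) = B , Equivalence.to (bases⇔ B) basisB , X⊆B

  hasRank-cong : SameMatroid N N′ → HasRank N X r → HasRank N′ X r
  hasRank-cong same ((I , I⊆X , independentI , ∣I∣) , maximal) =
    (I , I⊆X , independent-cong same independentI , ∣I∣) ,
    λ J J⊆X independentJ → maximal J J⊆X (independent-cong (same-sym same) independentJ)

  flat-cong : SameMatroid N N′ → Flat N F → Flat N′ F
  flat-cong {F = F} same@(ground≡ , _) (F⊆ground , closed) =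
    subst (F ⊆_) ground≡ F⊆ground ,
    λ e e∈ e∉F r s rankF rankF+e →
      closed e (subst (e ∈_) (sym ground≡) e∈) e∉F r s
             (hasRank-cong (same-sym same) rankF) (hasRank-cong (same-sym same) rankF+e)

  principalExtension-cong : SameMatroid N N′ →
                            SameMatroid (principalExtension N F a) (principalExtension N′ F a)
  principalExtension-cong {a = a} same@(ground≡ , _) =
    cong (_∪ ⁅ a ⁆) ground≡ , λ X → mk⇔ (transfer same) (transfer (same-sym same))
    where
    transfer : ∀ {N N′ X} → SameMatroid N N′ →
               isBasis (principalExtension N _ a) X → isBasis (principalExtension N′ _ a) X
    transfer (_ , bases⇔) (inj₁ basisX) = inj₁ (Equivalence.to (bases⇔ _) basisX)
    transfer (_ , bases⇔) (inj₂ (L , b , basisL , rest)) =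
      inj₂ (L , b , Equivalence.to (bases⇔ L) basisL , rest)

  extSeq-congˡ : ∀ {M} → SameMatroid N N′ → ExtSeq n N′ M → ExtSeq n N M
  extSeq-congˡ same (done same′) = done (same-trans same same′)
  extSeq-congˡ same@(ground≡ , _) (step F a r a∉ flatF rankF r+2≡n rest) =
    step F a r (a∉ ∘ subst (a ∈_) ground≡) (flat-cong (same-sym same) flatF)
         (hasRank-cong (same-sym same) rankF) r+2≡n (extSeq-congˡ (principalExtension-cong same) rest)

-- This is the restriction M|E only when E contains a basis of M.
restriction : PreMatroid d → Subset d → PreMatroid d
restriction M E = record { ground = E ; isBasis = λ X → isBasis M X × X ⊆ E }

module MatroidTheory {d : ℕ} (M : PreMatroid d) (isMatroid : IsMatroid M) where

  open IsMatroid isMatroid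

  private variable
    B B′ Z C I X : Subset d
    n : ℕ

  independent-⊆ : Independent M X → I ⊆ X → Independent M I
  independent-⊆ (B , basisB , X⊆B) I⊆X = B , basisB , X⊆B ∘ I⊆X

  basis⇒independent : isBasis M B → Independent M B
  basis⇒independent basisB = _ , basisB , ⊆-refl

  -- Induction on B ─ S: each exchange trades a point of B outside S for a point of Z ⊆ S.
  exchange-into : ∀ {S} → isBasis M B → isBasis M Z → Z ⊆ S →
                  ∃[ B′ ] (isBasis M B′ × B′ ⊆ S × B ∩ S ⊆ B′ × ∣ B′ ∣ ≡ ∣ B ∣)
  exchange-into {B} {Z} {S} basisB basisZ Z⊆S = go B basisB (⊂-wellFounded (B ─ S))
    where
    go : ∀ B → isBasis M B → Acc _⊂_ (B ─ S) →
         ∃[ B′ ] (isBasis M B′ × B′ ⊆ S × B ∩ S ⊆ B′ × ∣ B′ ∣ ≡ ∣ B ∣)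
    go B basisB (acc smaller) with ⊆-or-∃∉ B S
    ... | inj₁ B⊆S = B , basisB , B⊆S , p∩q⊆p B S , refl
    ... | inj₂ (x , x∈B , x∉S) with exchange B Z x basisB basisZ x∈B (x∉S ∘ Z⊆S)
    ... | y , y∈Z , y∉B , basisB₁ with go ((B - x) ∪ ⁅ y ⁆) basisB₁ (smaller B₁─S⊂B─S)
      where
      B₁─S⊂B─S : ((B - x) ∪ ⁅ y ⁆) ─ S ⊂ B ─ S
      B₁─S⊂B─S = shrink , x , x∈p∧x∉q⇒x∈p─q x∈B x∉S , x∉B₁─S
        where
        shrink : ((B - x) ∪ ⁅ y ⁆) ─ S ⊆ B ─ S
        shrink z∈ with x∈p─q⁻ ((B - x) ∪ ⁅ y ⁆) S z∈
        ... | z∈B₁ , z∉S with x∈p∪⁅y⁆⁻ (B - x) z∈B₁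
        ... | inj₁ z∈B-x = x∈p∧x∉q⇒x∈p─q (p-x⊆p z∈B-x) z∉S
        ... | inj₂ refl  = contradiction (Z⊆S y∈Z) z∉S
        x∉B₁─S : x ∉ ((B - x) ∪ ⁅ y ⁆) ─ S
        x∉B₁─S x∈ with x∈p∪⁅y⁆⁻ (B - x) (proj₁ (x∈p─q⁻ _ S x∈))
        ... | inj₁ x∈B-x = proj₂ (x∈p-y⁻ x∈B-x) refl
        ... | inj₂ refl  = x∉S (Z⊆S y∈Z)
    ... | B′ , basisB′ , B′⊆S , B₁∩S⊆B′ , ∣B′∣ =
      B′ , basisB′ , B′⊆S , B∩S⊆B′ , trans ∣B′∣ (∣p-x∪⁅y⁆∣≡∣p∣ x∈B y∉B)
      where
      B∩S⊆B′ : B ∩ S ⊆ B′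
      B∩S⊆B′ {z} z∈ with x∈p∩q⁻ B S z∈
      ... | z∈B , z∈S = B₁∩S⊆B′ (x∈p∩q⁺ (x∈p∪q⁺ (inj₁ (x∈p∧x≢y⇒x∈p-y z∈B λ { refl → x∉S z∈S })) , z∈S))

  basis-card-≤ : isBasis M B → isBasis M B′ → ∣ B ∣ ≤ ∣ B′ ∣
  basis-card-≤ basisB basisB′ with exchange-into basisB basisB′ ⊆-refl
  ... | _ , _ , B″⊆B′ , _ , ∣B″∣ = subst (_≤ _) ∣B″∣ (p⊆q⇒∣p∣≤∣q∣ B″⊆B′)

  bases-equicardinal : isBasis M B → isBasis M B′ → ∣ B ∣ ≡ ∣ B′ ∣
  bases-equicardinal basisB basisB′ = ≤-antisym (basis-card-≤ basisB basisB′) (basis-card-≤ basisB′ basisB)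

  basis-card : MatroidRank M n → isBasis M B → ∣ B ∣ ≡ n
  basis-card ((I , _ , (B′ , basisB′ , I⊆B′) , ∣I∣) , maximal) basisB =
    ≤-antisym (maximal _ (basis-ground _ basisB) (basis⇒independent basisB))
              (subst (_≤ _) ∣I∣ (≤-trans (p⊆q⇒∣p∣≤∣q∣ I⊆B′)
                                         (≤-reflexive (bases-equicardinal basisB′ basisB))))

  independent-extends-within : Independent M I → isBasis M Z → ∃[ B ] (isBasis M B × I ⊆ B × B ⊆ I ∪ Z)
  independent-extends-within {I} {Z} (B , basisB , I⊆B) basisZ with exchange-into basisB basisZ (q⊆p∪q I Z)
  ... | B′ , basisB′ , B′⊆I∪Z , B∩I∪Z⊆B′ , _ =
    B′ , basisB′ , (λ x∈I → B∩I∪Z⊆B′ (x∈p∩q⁺ (I⊆B x∈I , p⊆p∪q Z x∈I))) , B′⊆I∪Z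

  independent-card⇒basis : Independent M I → isBasis M B → ∣ B ∣ ≤ ∣ I ∣ → isBasis M I
  independent-card⇒basis (B′ , basisB′ , I⊆B′) basisB ∣B∣≤∣I∣ =
    subst (isBasis M) (sym (⊆∧∣q∣≤∣p∣⇒p≡q I⊆B′ (subst (_≤ _) (bases-equicardinal basisB basisB′) ∣B∣≤∣I∣)))
          basisB′

  basis-maximal : isBasis M B → y ∉ B → ¬ Independent M (B ∪ ⁅ y ⁆)
  basis-maximal {B} basisB y∉B (B′ , basisB′ , B+y⊆B′) =
    <-irrefl (bases-equicardinal basisB basisB′)
             (subst (_≤ ∣ B′ ∣) (∣p∪⁅y⁆∣≡1+∣p∣ B y∉B) (p⊆q⇒∣p∣≤∣q∣ B+y⊆B′))

  circuit-swap : isBasis M Z → Circuit M C → C ⊆ Z ∪ ⁅ y ⁆ → x ∈ C → x ∈ Z → y ∉ Z →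
                 isBasis M ((Z - x) ∪ ⁅ y ⁆)
  circuit-swap {Z} {C} {y} {x} basisZ ((_ , dependentC) , minimalC) C⊆Z+y x∈C x∈Z y∉Z
    with independent-extends-within (minimalC (C - x) p-x⊆p C-x≢C) basisZ
    where
    C-x≢C : C - x ≢ C
    C-x≢C C-x≡C = proj₂ (x∈p-y⁻ (subst (x ∈_) (sym C-x≡C) x∈C)) refl
  ... | B , basisB , C-x⊆B , B⊆C-x∪Z =
    subst (isBasis M) (⊆∧∣q∣≤∣p∣⇒p≡q B⊆Z-x+y (≤-reflexive ∣Z-x+y∣≡∣B∣)) basisB
    where
    x∉B : x ∉ B
    x∉B x∈B = dependentC (B , basisB , ∪⁅⁆-least C-x⊆B x∈B ∘ p⊆p-x∪⁅x⁆)
    B⊆Z-x+y : B ⊆ (Z - x) ∪ ⁅ y ⁆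
    B⊆Z-x+y z∈B with x∈p∪q⁻ (C - x) Z (B⊆C-x∪Z z∈B)
    ... | inj₁ z∈C-x = ∈-swap⁺ Z (C⊆Z+y (p-x⊆p z∈C-x)) λ { refl → x∉B z∈B }
    ... | inj₂ z∈Z   = ∈-swap⁺ Z (p⊆p∪q _ z∈Z) λ { refl → x∉B z∈B }
    ∣Z-x+y∣≡∣B∣ : ∣ (Z - x) ∪ ⁅ y ⁆ ∣ ≡ ∣ B ∣
    ∣Z-x+y∣≡∣B∣ = trans (∣p-x∪⁅y⁆∣≡∣p∣ x∈Z y∉Z) (bases-equicardinal basisZ basisB)

  dependent-contains-circuit : X ⊆ ground M → ¬ Independent M X → ¬ ¬ (∃[ C ] (C ⊆ X × Circuit M C))
  dependent-contains-circuit = go (⊂-wellFounded _)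
    where
    go : Acc _⊂_ X → X ⊆ ground M → ¬ Independent M X → ¬ ¬ (∃[ C ] (C ⊆ X × Circuit M C))
    go {X} (acc smaller) X⊆E dependentX ∄C =
      ¬¬-∀-Subset proper⇒independent λ minimal → ∄C (X , ⊆-refl , (X⊆E , dependentX) , minimal)
      where
      proper⇒independent : ∀ Y → ¬ ¬ (Y ⊆ X → Y ≢ X → Independent M Y)
      proper⇒independent Y k = ¬¬-excluded-middle λ where
        (yes independentY) → k λ _ _ → independentY
        (no dependentY)    → k λ Y⊆X Y≢X →
          ⊥-elim (go (smaller (⊆∧≢⇒⊂ Y⊆X Y≢X)) (X⊆E ∘ Y⊆X) dependentY
                     λ (C , C⊆Y , circuitC) → ∄C (C , Y⊆X ∘ C⊆Y , circuitC))

  module _ (circuit-in? : ∀ X → Dec (∃[ C ] (C ⊆ X × Circuit M C))) where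

    circuit-in-dependent : X ⊆ ground M → ¬ Independent M X → ∃[ C ] (C ⊆ X × Circuit M C)
    circuit-in-dependent X⊆E dependentX =
      decidable-stable (circuit-in? _) (dependent-contains-circuit X⊆E dependentX)

    circuit-free⇒independent : X ⊆ ground M → (∀ C → C ⊆ X → ¬ Circuit M C) → Independent M X
    circuit-free⇒independent = go (⊂-wellFounded _)
      where
      go : Acc _⊂_ X → X ⊆ ground M → (∀ C → C ⊆ X → ¬ Circuit M C) → Independent M X
      go {X} (acc smaller) X⊆E circuit-free with nonempty? X
      ... | no empty =
        let (B , basisB) = basis-exists in B , basisB , λ x∈X → contradiction (_ , x∈X) empty
      ... | yes (y , y∈X)
        with go (smaller (x∈p⇒p-x⊂p y∈X)) (X⊆E ∘ p-x⊆p) (λ C C⊆X-y → circuit-free C (p-x⊆p ∘ C⊆X-y))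
      ... | Z , basisZ , X-y⊆Z with y ∈? Z
      ...   | yes y∈Z = Z , basisZ , ∪⁅⁆-least ⊆-refl y∈Z ∘ p-x⊆q⇒p⊆q∪⁅x⁆ X-y⊆Z
      ...   | no y∉Z
        with circuit-in-dependent (∪⁅⁆-least (basis-ground Z basisZ) (X⊆E y∈X)) (basis-maximal basisZ y∉Z)
      ... | C , C⊆Z+y , circuitC with ⊆-or-∃∉ C X
      ...   | inj₁ C⊆X = ⊥-elim (circuit-free C C⊆X circuitC)
      ...   | inj₂ (x , x∈C , x∉X) =
        _ , circuit-swap basisZ circuitC C⊆Z+y x∈C x∈Z y∉Z ,
        λ z∈X → ∈-swap⁺ Z (p-x⊆q⇒p⊆q∪⁅x⁆ X-y⊆Z z∈X) λ { refl → x∉X z∈X }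
        where
        x∈Z : x ∈ Z
        x∈Z with x∈p∪⁅y⁆⁻ Z (C⊆Z+y x∈C)
        ... | inj₁ x∈Z = x∈Z
        ... | inj₂ refl = contradiction y∈X x∉X

  module Restriction {E B : Subset d} (E⊆ground : E ⊆ ground M) (basisB : isBasis M B) (B⊆E : B ⊆ E) where

    N : PreMatroid d
    N = restriction M E

    independent-restriction⁻ : Independent N X → Independent M X
    independent-restriction⁻ (B′ , (basisB′ , _) , X⊆B′) = B′ , basisB′ , X⊆B′

    independent-restriction⁺ : X ⊆ E → Independent M X → Independent N X
    independent-restriction⁺ X⊆E independentX with independent-extends-within independentX basisB
    ... | B′ , basisB′ , X⊆B′ , B′⊆X∪B = B′ , (basisB′ , ∪-least X⊆E B⊆E ∘ B′⊆X∪B) , X⊆B′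

    circuit-restriction⁻ : Circuit N X → Circuit M X
    circuit-restriction⁻ ((X⊆E , dependentX) , minimalX) =
      (E⊆ground ∘ X⊆E , dependentX ∘ independent-restriction⁺ X⊆E) ,
      λ Y Y⊆X Y≢X → independent-restriction⁻ (minimalX Y Y⊆X Y≢X)

    circuit-restriction⁺ : X ⊆ E → Circuit M X → Circuit N X
    circuit-restriction⁺ X⊆E ((_ , dependentX) , minimalX) =
      (X⊆E , dependentX ∘ independent-restriction⁻) ,
      λ Y Y⊆X Y≢X → independent-restriction⁺ (X⊆E ∘ Y⊆X) (minimalX Y Y⊆X Y≢X)

    restriction-isMatroid : IsMatroid N
    restriction-isMatroid = record
      { basis-exists = B , basisB , B⊆E
      ; basis-ground = λ _ → proj₂
      ; exchange     = λ B₁ B₂ x (basisB₁ , B₁⊆E) (basisB₂ , B₂⊆E) x∈B₁ x∉B₂ →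
          let (y , y∈B₂ , y∉B₁ , basisB₁′) = exchange B₁ B₂ x basisB₁ basisB₂ x∈B₁ x∉B₂
          in  y , y∈B₂ , y∉B₁ , basisB₁′ , swap-⊆ B₁⊆E (B₂⊆E y∈B₂)
      }

    restriction-rank : MatroidRank M n → MatroidRank N n
    restriction-rank rank@(_ , maximal) =
      (B , B⊆E , independent-restriction⁺ B⊆E (basis⇒independent basisB) , basis-card rank basisB) ,
      λ I I⊆E independentI → maximal I (E⊆ground ∘ I⊆E) (independent-restriction⁻ independentI)

module QuasiPaving {d k : ℕ} (n : ℕ) (H : Fin k → Subset d) (threewise : ThreewiseDisjoint H) where

  private variable
    X Y E E′ : Subset d
    a e : Fin d
    i j l : Fin k

  InPairIntersection : Subset d → Set
  InPairIntersection X = ∃[ i ] ∃[ j ] (i ≢ j × X ⊆ H i ∩ H j)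

  Type1Free : Subset d → Set
  Type1Free X = ¬ (∃[ Y ] (Y ⊆ X × Type1 n H Y))

  Type1Witness : Subset d → Fin d → Set
  Type1Witness E a = ∃[ Y ] (Type1 n H Y × a ∈ Y × Y - a ⊆ E)

  inPairIntersection? : ∀ X → Dec (InPairIntersection X)
  inPairIntersection? X = any? λ i → any? λ j → ¬? (i ≟ᶠ j) ×-dec X ⊆? H i ∩ H j

  type1? : ∀ X → Dec (Type1 n H X)
  type1? X = suc ∣ X ∣ ≟ n ×-dec inPairIntersection? X

  type1-in? : ∀ X → Dec (∃[ Y ] (Y ⊆ X × Type1 n H Y))
  type1-in? X = anySubset? λ Y → Y ⊆? X ×-dec type1? Y

  type2? : ∀ X → Dec (Type2 n H X)
  type2? X = ∣ X ∣ ≟ n ×-dec any? (λ i → X ⊆? H i) ×-dec ¬? (type1-in? X)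

  type3? : ∀ X → Dec (Type3 n H X)
  type3? X = ∣ X ∣ ≟ suc n ×-dec ¬? (anySubset? λ Y → Y ⊆? X ×-dec (type1? Y ⊎-dec type2? Y))

  qpCircuit? : ∀ X → Dec (QPCircuit n H X)
  qpCircuit? X = type1? X ⊎-dec type2? X ⊎-dec type3? X

  -- l is i or j, as e ∈ H i ∩ H j ∩ H l.
  ∩-⊆ : i ≢ j → e ∈ H i ∩ H j → e ∈ H l → H i ∩ H j ⊆ H l
  ∩-⊆ {i} {j} {l = l} i≢j e∈Hi∩Hj e∈Hl with l ≟ᶠ i | l ≟ᶠ j | x∈p∩q⁻ (H i) (H j) e∈Hi∩Hj
  ... | yes refl | _        | _ = proj₁ ∘ x∈p∩q⁻ _ _
  ... | no _     | yes refl | _ = proj₂ ∘ x∈p∩q⁻ _ _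
  ... | no l≢i   | no l≢j   | e∈Hi , e∈Hj =
    contradiction (subst (_ ∈_) (threewise i j l i≢j (l≢i ∘ sym) (l≢j ∘ sym))
                                (x∈p∩q⁺ (e∈Hi , x∈p∩q⁺ (e∈Hj , e∈Hl))))
                  ∉⊥

  type1Witness : Type1Free E → ∃[ Y ] (Y ⊆ E ∪ ⁅ a ⁆ × Type1 n H Y) → Type1Witness E a
  type1Witness {a = a} free (Y , Y⊆E+a , type1Y) with a ∈? Y
  ... | yes a∈Y = Y , type1Y , a∈Y , p⊆q∪⁅x⁆⇒p-x⊆q Y⊆E+a
  ... | no a∉Y  = ⊥-elim (free (Y , p⊆q∪⁅x⁆∧x∉p⇒p⊆q Y⊆E+a a∉Y , type1Y))

  type1Witness-mono : E ⊆ E′ → Type1Witness E a → Type1Witness E′ a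
  type1Witness-mono E⊆E′ (Y , type1Y , a∈Y , Y-a⊆E) = Y , type1Y , a∈Y , E⊆E′ ∘ Y-a⊆E

  maximal-Type1-free : Acc _⊃_ E → Type1Free E →
                       ∃[ E′ ] (E ⊆ E′ × Type1Free E′ × (∀ a → a ∉ E′ → Type1Witness E′ a))
  maximal-Type1-free {E} (acc larger) free with any? (λ a → ¬? (a ∈? E) ×-dec ¬? (type1-in? (E ∪ ⁅ a ⁆)))
  ... | yes (a , a∉E , free′) =
    let (E′ , E+a⊆E′ , rest) = maximal-Type1-free (larger (p⊆p∪q _ , a , y∈p∪⁅y⁆ , a∉E)) free′
    in  E′ , E+a⊆E′ ∘ p⊆p∪q _ , rest
  ... | no maximal = E , ⊆-refl , free , λ a a∉E →
    type1Witness free (decidable-stable (type1-in? (E ∪ ⁅ a ⁆)) λ free′ → maximal (a , a∉E , free′))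

module QuasiPavingMatroid {d k : ℕ} (n : ℕ) (H : Fin k → Subset d) (threewise : ThreewiseDisjoint H)
  (M : PreMatroid d) (isMatroid : IsMatroid M) (ground≡⊤ : ground M ≡ ⊤) (rank : MatroidRank M n)
  (circuit⇔ : ∀ X → Circuit M X ⇔ QPCircuit n H X) where

  open QuasiPaving n H threewise public
  open MatroidTheory M isMatroid public

  private variable
    C I S W X Y : Subset d
    u v : Fin d
    i j l : Fin k

  ⊆ground : X ⊆ ground M
  ⊆ground {X} = subst (X ⊆_) (sym ground≡⊤) ⊆⊤

  qpCircuit⇒dependent : QPCircuit n H C → ¬ Independent M C
  qpCircuit⇒dependent {C} = proj₂ ∘ proj₁ ∘ Equivalence.from (circuit⇔ C)

  qpCircuit-minimal : QPCircuit n H C → Y ⊆ C → Y ≢ C → Independent M Y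
  qpCircuit-minimal {C} {Y} circuitC = proj₂ (Equivalence.from (circuit⇔ C) circuitC) Y

  qpCircuit-free⇒independent : (∀ C → C ⊆ X → ¬ QPCircuit n H C) → Independent M X
  qpCircuit-free⇒independent free =
    circuit-free⇒independent circuit-in? ⊆ground λ C C⊆X → free C C⊆X ∘ Equivalence.to (circuit⇔ C)
    where
    circuit-in? : ∀ X → Dec (∃[ C ] (C ⊆ X × Circuit M C))
    circuit-in? X = map′
      (Product.map₂ (Product.map₂ (Equivalence.from (circuit⇔ _))))
      (Product.map₂ (Product.map₂ (Equivalence.to (circuit⇔ _))))
      (anySubset? λ C → C ⊆? X ×-dec qpCircuit? C)

  independent⇒Type1Free : Independent M I → Type1Free I
  independent⇒Type1Free independentI (Y , Y⊆I , type1Y) =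
    qpCircuit⇒dependent (inj₁ type1Y) (independent-⊆ independentI Y⊆I)

  independent-⊆H⇒∣∣≢n : Independent M I → I ⊆ H i → ∣ I ∣ ≢ n
  independent-⊆H⇒∣∣≢n {I} {i} independentI I⊆Hi ∣I∣≡n with type1-in? I
  ... | yes type1-in = independent⇒Type1Free independentI type1-in
  ... | no free      = qpCircuit⇒dependent (inj₂ (inj₁ (∣I∣≡n , (i , I⊆Hi) , free))) independentI

  -- Threewise disjointness makes u and v lie in exactly the same sets H l, so the swap maps
  -- circuits inside the new set to circuits of the same type inside W.
  basis-swap : isBasis M W → u ∈ W → v ∉ W → i ≢ j → u ∈ H i ∩ H j → v ∈ H i ∩ H j →
               isBasis M ((W - u) ∪ ⁅ v ⁆)
  basis-swap {W} {u} {v} {i} {j} basisW u∈W v∉W i≢j u∈Hij v∈Hij =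
    independent-card⇒basis (qpCircuit-free⇒independent no-circuit) basisW (≤-reflexive (sym ∣V∣≡∣W∣))
    where
    independentW : Independent M W
    independentW = basis⇒independent basisW
    ∣V∣≡∣W∣ : ∣ (W - u) ∪ ⁅ v ⁆ ∣ ≡ ∣ W ∣
    ∣V∣≡∣W∣ = ∣p-x∪⁅y⁆∣≡∣p∣ u∈W v∉W
    twin : v ∈ H l → u ∈ H l
    twin v∈Hl = ∩-⊆ i≢j v∈Hij v∈Hl u∈Hij
    no-circuit : ∀ C → C ⊆ (W - u) ∪ ⁅ v ⁆ → ¬ QPCircuit n H C
    no-circuit C C⊆V circuitC with v ∈? C
    ... | no v∉C = qpCircuit⇒dependent circuitC (independent-⊆ independentW (p-x⊆p ∘ p⊆q∪⁅x⁆∧x∉p⇒p⊆q C⊆V v∉C))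
    ... | yes v∈C = swapped circuitC
      where
      C′⊆W : (C - v) ∪ ⁅ u ⁆ ⊆ W
      C′⊆W = ∪⁅⁆-least (p-x⊆p ∘ p⊆q∪⁅x⁆⇒p-x⊆q C⊆V) u∈W
      u∉C : u ∉ C
      u∉C u∈C with x∈p∪⁅y⁆⁻ (W - u) (C⊆V u∈C)
      ... | inj₁ u∈W-u = proj₂ (x∈p-y⁻ u∈W-u) refl
      ... | inj₂ refl  = v∉W u∈W
      ∣C′∣≡∣C∣ : ∣ (C - v) ∪ ⁅ u ⁆ ∣ ≡ ∣ C ∣
      ∣C′∣≡∣C∣ = ∣p-x∪⁅y⁆∣≡∣p∣ v∈C u∉C
      swapped : ¬ QPCircuit n H C
      swapped (inj₁ (∣C∣+1≡n , l , l′ , l≢l′ , C⊆Hll′)) =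
        independent⇒Type1Free independentW
          ((C - v) ∪ ⁅ u ⁆ , C′⊆W , trans (cong suc ∣C′∣≡∣C∣) ∣C∣+1≡n , l , l′ , l≢l′ ,
           swap-⊆ C⊆Hll′ (x∈p∩q⁺ (Product.map twin twin (x∈p∩q⁻ (H l) (H l′) (C⊆Hll′ v∈C)))))
      swapped (inj₂ (inj₁ (∣C∣≡n , (l , C⊆Hl) , _))) =
        independent-⊆H⇒∣∣≢n (independent-⊆ independentW C′⊆W) (swap-⊆ C⊆Hl (twin (C⊆Hl v∈C)))
                            (trans ∣C′∣≡∣C∣ ∣C∣≡n)
      swapped (inj₂ (inj₂ (∣C∣≡1+n , _))) =
        1+n≰n (subst (_≤ n) ∣C∣≡1+n (≤-trans (p⊆q⇒∣p∣≤∣q∣ C⊆V)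
                                             (≤-reflexive (trans ∣V∣≡∣W∣ (basis-card rank basisW)))))

  module _ {B : Subset d} (basisB : isBasis M B) where

    module AddElement {E Y : Subset d} {a : Fin d} {i j : Fin k} (B⊆E : B ⊆ E) (a∉E : a ∉ E)
      (∣Y∣+1≡n : suc ∣ Y ∣ ≡ n) (i≢j : i ≢ j) (Y⊆Hij : Y ⊆ H i ∩ H j) (a∈Y : a ∈ Y) (Y-a⊆E : Y - a ⊆ E)
      where

      open Restriction ⊆ground basisB B⊆E

      type1Y : Type1 n H Y
      type1Y = ∣Y∣+1≡n , i , j , i≢j , Y⊆Hij

      K : Subset d
      K = Y - a

      2+∣K∣≡n : 2 + ∣ K ∣ ≡ n
      2+∣K∣≡n = trans (cong suc (1+∣p-x∣≡∣p∣ Y a∈Y)) ∣Y∣+1≡n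

      inF? : ∀ e → Dec (e ∈ E × InPairIntersection (K ∪ ⁅ e ⁆))
      inF? e = e ∈? E ×-dec inPairIntersection? (K ∪ ⁅ e ⁆)

      -- E ∩ H i ∩ H j when K ≠ ∅; the loops of E when K = ∅ (that is, n = 2).
      F : Subset d
      F = select inF?

      F⊆E : F ⊆ E
      F⊆E = proj₁ ∘ ∈-select⁻ inF?

      K⊆F : K ⊆ F
      K⊆F e∈K = ∈-select⁺ inF? (Y-a⊆E e∈K , i , j , i≢j , ∪⁅⁆-least (Y⊆Hij ∘ p-x⊆p) (Y⊆Hij (p-x⊆p e∈K)))

      ∈F⇒∈Hij⊎loop : ∀ {e} → e ∈ F → e ∈ H i ∩ H j ⊎ Type1 n H ⁅ e ⁆
      ∈F⇒∈Hij⊎loop {e} e∈F with ∈-select⁻ inF? e∈F | nonempty? K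
      ... | _ , l , l′ , l≢l′ , K+e⊆Hll′ | yes (c , c∈K) =
        inj₁ (x∈p∩q⁺ (Product.map through through (x∈p∩q⁻ (H i) (H j) (Y⊆Hij (p-x⊆p c∈K)))))
        where
        c∈Hll′ : c ∈ H l ∩ H l′
        c∈Hll′ = K+e⊆Hll′ (p⊆p∪q _ c∈K)
        through : ∀ {h} → c ∈ H h → e ∈ H h
        through c∈Hh = ∩-⊆ l≢l′ c∈Hll′ c∈Hh (K+e⊆Hll′ y∈p∪⁅y⁆)
      ... | _ , l , l′ , l≢l′ , K+e⊆Hll′ | no K-empty =
        inj₂ (size , l , l′ , l≢l′ , K+e⊆Hll′ ∘ q⊆p∪q K ⁅ e ⁆)
        where
        ∣K∣≡0 : ∣ K ∣ ≡ 0
        ∣K∣≡0 = trans (cong ∣_∣ (Empty-unique K-empty)) (∣⊥∣≡0 d)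
        size : suc ∣ ⁅ e ⁆ ∣ ≡ n
        size = trans (cong suc (trans (∣⁅x⁆∣≡1 e) (cong suc (sym ∣K∣≡0)))) 2+∣K∣≡n

      independent∩F⊆Hij : ∀ {e} → Independent M I → e ∈ I → e ∈ F → e ∈ H i ∩ H j
      independent∩F⊆Hij {e = e} independentI e∈I e∈F with ∈F⇒∈Hij⊎loop e∈F
      ... | inj₁ e∈Hij = e∈Hij
      ... | inj₂ loop  = ⊥-elim (independent⇒Type1Free independentI (⁅ e ⁆ , ⁅x⁆⊆p e∈I , loop))

      independent⊆F⇒∣∣≤∣K∣ : Independent M I → I ⊆ F → ∣ I ∣ ≤ ∣ K ∣
      independent⊆F⇒∣∣≤∣K∣ {I} independentI I⊆F with ∣ I ∣ ≤? ∣ K ∣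
      ... | yes ∣I∣≤∣K∣ = ∣I∣≤∣K∣
      ... | no ∣I∣≰∣K∣ with ∃-⊆-of-size (suc ∣ K ∣) I (≰⇒> ∣I∣≰∣K∣)
      ...   | Z , Z⊆I , ∣Z∣≡1+∣K∣ = ⊥-elim (independent⇒Type1Free independentI
                (Z , Z⊆I , trans (cong suc ∣Z∣≡1+∣K∣) 2+∣K∣≡n , i , j , i≢j ,
                 λ z∈Z → independent∩F⊆Hij independentI (Z⊆I z∈Z) (I⊆F (Z⊆I z∈Z))))

      K+e-independent : ∀ {e} → e ∈ E → e ∉ F → Independent M (K ∪ ⁅ e ⁆)
      K+e-independent {e} e∈E e∉F = qpCircuit-free⇒independent no-circuit
        where
        ∣K+e∣≡1+∣K∣ : ∣ K ∪ ⁅ e ⁆ ∣ ≡ suc ∣ K ∣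
        ∣K+e∣≡1+∣K∣ = ∣p∪⁅y⁆∣≡1+∣p∣ K (e∉F ∘ K⊆F)
        no-circuit : ∀ C → C ⊆ K ∪ ⁅ e ⁆ → ¬ QPCircuit n H C
        no-circuit C C⊆K+e circuitC with ≤-trans (p⊆q⇒∣p∣≤∣q∣ C⊆K+e) (≤-reflexive ∣K+e∣≡1+∣K∣) | circuitC
        ... | ∣C∣≤1+∣K∣ | inj₁ (∣C∣+1≡n , inPair) =
          e∉F (∈-select⁺ inF? (e∈E , subst InPairIntersection C≡K+e inPair))
          where
          C≡K+e : C ≡ K ∪ ⁅ e ⁆
          C≡K+e = ⊆∧∣q∣≤∣p∣⇒p≡q C⊆K+e (≤-reflexive (suc-injective (trans (cong suc ∣K+e∣≡1+∣K∣)
                                                                         (trans 2+∣K∣≡n (sym ∣C∣+1≡n)))))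
        ... | ∣C∣≤1+∣K∣ | inj₂ (inj₁ (∣C∣≡n , _)) =
          1+n≰n (subst (_≤ suc ∣ K ∣) (trans ∣C∣≡n (sym 2+∣K∣≡n)) ∣C∣≤1+∣K∣)
        ... | ∣C∣≤1+∣K∣ | inj₂ (inj₂ (∣C∣≡1+n , _)) =
          1+n≰n (≤-trans (n≤1+n _) (subst (_≤ suc ∣ K ∣) (trans ∣C∣≡1+n (cong suc (sym 2+∣K∣≡n))) ∣C∣≤1+∣K∣))

      F-rank : HasRank N F ∣ K ∣
      F-rank = (K , K⊆F , independent-restriction⁺ Y-a⊆E independentK , refl) ,
               λ I I⊆F independentI → independent⊆F⇒∣∣≤∣K∣ (independent-restriction⁻ independentI) I⊆F
        where
        independentK : Independent M K
        independentK = qpCircuit-minimal (inj₁ type1Y) p-x⊆p λ K≡Y →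
          proj₂ (x∈p-y⁻ (subst (a ∈_) (sym K≡Y) a∈Y)) refl

      F-flat : Flat N F
      F-flat = F⊆E , λ e e∈E e∉F r s ((I , I⊆F , independentI , ∣I∣≡r) , _) (_ , maximal) →
        begin-strict
          r                 ≡⟨ sym ∣I∣≡r ⟩
          ∣ I ∣             ≤⟨ independent⊆F⇒∣∣≤∣K∣ (independent-restriction⁻ independentI) I⊆F ⟩
          ∣ K ∣             <⟨ n<1+n _ ⟩
          suc ∣ K ∣         ≡⟨ sym (∣p∪⁅y⁆∣≡1+∣p∣ K (e∉F ∘ K⊆F)) ⟩
          ∣ K ∪ ⁅ e ⁆ ∣     ≤⟨ maximal (K ∪ ⁅ e ⁆) (∪⁅⁆-least (p⊆p∪q _ ∘ K⊆F) y∈p∪⁅y⁆)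
                                (independent-restriction⁺ (∪⁅⁆-least Y-a⊆E e∈E) (K+e-independent e∈E e∉F)) ⟩
          s                 ∎
        where open ≤-Reasoning

      extension≡restriction : SameMatroid (principalExtension N F a) (restriction M (E ∪ ⁅ a ⁆))
      extension≡restriction = refl , λ X → mk⇔ to from
        where
        a∈Hij : a ∈ H i ∩ H j
        a∈Hij = Y⊆Hij a∈Y
        to : ∀ {X} → isBasis (principalExtension N F a) X → isBasis (restriction M (E ∪ ⁅ a ⁆)) X
        to (inj₁ (basisX , X⊆E)) = basisX , p⊆p∪q _ ∘ X⊆E
        to (inj₂ (L , b , (basisL , L⊆E) , b∈L , b∈F , refl)) =
          basis-swap basisL b∈L (a∉E ∘ L⊆E) i≢j (independent∩F⊆Hij (basis⇒independent basisL) b∈L b∈F) a∈Hij ,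
          swap-⊆ (p⊆p∪q _ ∘ L⊆E) y∈p∪⁅y⁆
        from : ∀ {X} → isBasis (restriction M (E ∪ ⁅ a ⁆)) X → isBasis (principalExtension N F a) X
        from {X} (basisX , X⊆E+a) with a ∈? X
        ... | no a∉X = inj₁ (basisX , p⊆q∪⁅x⁆∧x∉p⇒p⊆q X⊆E+a a∉X)
        ... | yes a∈X with ⊆-or-∃∉ Y X
        ...   | inj₁ Y⊆X = ⊥-elim (independent⇒Type1Free (basis⇒independent basisX) (Y , Y⊆X , type1Y))
        ...   | inj₂ (b , b∈Y , b∉X) =
          inj₂ ((X - a) ∪ ⁅ b ⁆ , b ,
                (basis-swap basisX a∈X b∉X i≢j a∈Hij (Y⊆Hij b∈Y) ,
                 ∪⁅⁆-least (p⊆q∪⁅x⁆⇒p-x⊆q X⊆E+a) (Y-a⊆E b∈K)) ,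
                y∈p∪⁅y⁆ , K⊆F b∈K , sym (swap-involutive a∈X b∉X))
          where
          b∈K : b ∈ K
          b∈K = x∈p∧x≢y⇒x∈p-y b∈Y λ { refl → b∉X a∈X }

    extension-sequence : ∀ {E} → Acc _⊃_ E → B ⊆ E → (∀ a → a ∉ E → Type1Witness E a) →
                         ExtSeq n (restriction M E) M
    extension-sequence {E} (acc larger) B⊆E attached with ⊆-or-∃∉ ⊤ E
    ... | inj₁ ⊤⊆E = done (E≡ground , λ X → mk⇔ proj₁ (λ basisX → basisX , λ {_} _ → ⊤⊆E ∈⊤))
      where
      E≡ground : E ≡ ground M
      E≡ground = trans (⊆-antisym ⊆⊤ ⊤⊆E) (sym ground≡⊤)
    ... | inj₂ (a , _ , a∉E) with attached a a∉E
    ...   | Y , (∣Y∣+1≡n , i , j , i≢j , Y⊆Hij) , a∈Y , Y-a⊆E =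
      step F a ∣ K ∣ a∉E F-flat F-rank (trans (+-comm ∣ K ∣ 2) 2+∣K∣≡n)
           (extSeq-congˡ extension≡restriction
             (extension-sequence (larger (p⊆p∪q _ , a , y∈p∪⁅y⁆ , a∉E)) (p⊆p∪q _ ∘ B⊆E)
               λ b b∉E+a → type1Witness-mono (p⊆p∪q _) (attached b (b∉E+a ∘ p⊆p∪q _))))
      where open AddElement B⊆E a∉E ∣Y∣+1≡n i≢j Y⊆Hij a∈Y Y-a⊆E

    module Paving {E : Subset d} (B⊆E : B ⊆ E) (free : Type1Free E) (0<n : 0 < n) where

      open Restriction ⊆ground basisB B⊆E

      restriction-circuit⇒Type2⊎Type3 : Circuit N X → Type2 n H X ⊎ Type3 n H X
      restriction-circuit⇒Type2⊎Type3 {X} circuitX@((X⊆E , _) , _)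
        with Equivalence.to (circuit⇔ X) (circuit-restriction⁻ circuitX)
      ... | inj₁ type1X      = ⊥-elim (free (X , X⊆E , type1X))
      ... | inj₂ type2⊎type3 = type2⊎type3

      restriction-isPaving : IsPaving N n
      restriction-isPaving = restriction-isMatroid , restriction-rank rank ,
        λ C circuitC → Data.Sum.map proj₁ proj₁ (restriction-circuit⇒Type2⊎Type3 circuitC)

      n-circuit⇒⊆H : Circuit N X → ∣ X ∣ ≡ n → ∃[ i ] X ⊆ H i
      n-circuit⇒⊆H circuitX ∣X∣≡n with restriction-circuit⇒Type2⊎Type3 circuitX
      ... | inj₁ (_ , X⊆Hi , _) = X⊆Hi
      ... | inj₂ (∣X∣≡1+n , _)  = contradiction (trans (sym ∣X∣≡1+n) ∣X∣≡n) 1+n≢n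

      H-unique : X ⊆ E → suc ∣ X ∣ ≡ n → X ⊆ H i → X ⊆ H j → i ≡ j
      H-unique {X} {i} {j} X⊆E ∣X∣+1≡n X⊆Hi X⊆Hj = decidable-stable (i ≟ᶠ j) λ i≢j →
        free (X , X⊆E , ∣X∣+1≡n , i , j , i≢j , λ x∈X → x∈p∩q⁺ (X⊆Hi x∈X , X⊆Hj x∈X))

      -- Trading a point x of an n-subset X ⊆ H i for any e ∈ S gives an n-circuit in some H j;
      -- both contain the n - 1 points of X - x, so j = i by H-unique.
      n-subsets-circuits⇒⊆H : AllNSubsetsCircuits N n S → ∃[ i ] S ⊆ H i
      n-subsets-circuits⇒⊆H {S} (S⊆E , n≤∣S∣ , circuits) with ∃-⊆-of-size n S n≤∣S∣
      ... | X , X⊆S , ∣X∣≡n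
        with n-circuit⇒⊆H (circuits X X⊆S ∣X∣≡n) ∣X∣≡n | 0<∣p∣⇒nonempty X (subst (0 <_) (sym ∣X∣≡n) 0<n)
      ... | i , X⊆Hi | x , x∈X = i , S⊆Hi
        where
        S⊆Hi : S ⊆ H i
        S⊆Hi {e} e∈S with e ∈? X
        ... | yes e∈X = X⊆Hi e∈X
        ... | no e∉X with n-circuit⇒⊆H (circuits ((X - x) ∪ ⁅ e ⁆) (swap-⊆ X⊆S e∈S) ∣X′∣≡n) ∣X′∣≡n
          where
          ∣X′∣≡n : ∣ (X - x) ∪ ⁅ e ⁆ ∣ ≡ n
          ∣X′∣≡n = trans (∣p-x∪⁅y⁆∣≡∣p∣ x∈X e∉X) ∣X∣≡n
        ...   | j , X′⊆Hj =
          subst (λ h → e ∈ H h)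
                (H-unique (S⊆E ∘ X⊆S ∘ p-x⊆p) (trans (1+∣p-x∣≡∣p∣ X x∈X) ∣X∣≡n)
                          (X′⊆Hj ∘ p⊆p∪q _) (X⊆Hi ∘ p-x⊆p))
                (X′⊆Hj y∈p∪⁅y⁆)

      dependentHyperplane⇒E∩H : DependentHyperplane N n S → ∃[ i ] E ∩ H i ≡ S
      dependentHyperplane⇒E∩H {S} (nSubsets@(S⊆E , n≤∣S∣ , _) , maximal) with n-subsets-circuits⇒⊆H nSubsets
      ... | i , S⊆Hi =
        i , maximal (E ∩ H i) S⊆E∩Hi (p∩q⊆p E (H i) , ≤-trans n≤∣S∣ (p⊆q⇒∣p∣≤∣q∣ S⊆E∩Hi) , circuits)
        where
        S⊆E∩Hi : S ⊆ E ∩ H i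
        S⊆E∩Hi x∈S = x∈p∩q⁺ (S⊆E x∈S , S⊆Hi x∈S)
        circuits : ∀ X → X ⊆ E ∩ H i → ∣ X ∣ ≡ n → Circuit N X
        circuits X X⊆E∩Hi ∣X∣≡n = circuit-restriction⁺ (p∩q⊆p E (H i) ∘ X⊆E∩Hi)
          (Equivalence.from (circuit⇔ X) (inj₂ (inj₁ (∣X∣≡n , (i , p∩q⊆q E (H i) ∘ X⊆E∩Hi) ,
            λ (Y , Y⊆X , type1Y) → free (Y , p∩q⊆p E (H i) ∘ X⊆E∩Hi ∘ Y⊆X , type1Y)))))

      restriction-isTame : IsTame N n
      restriction-isTame S₁ S₂ S₃ h₁ h₂ h₃ S₁≢S₂ S₁≢S₃ S₂≢S₃
        with dependentHyperplane⇒E∩H h₁ | dependentHyperplane⇒E∩H h₂ | dependentHyperplane⇒E∩H h₃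
      ... | i₁ , refl | i₂ , refl | i₃ , refl =
        ⊆-antisym (subst ((E ∩ H i₁) ∩ (E ∩ H i₂) ∩ (E ∩ H i₃) ⊆_)
                         (threewise i₁ i₂ i₃ (distinct S₁≢S₂) (distinct S₁≢S₃) (distinct S₂≢S₃))
                         (∩-mono (p∩q⊆q E _) (∩-mono (p∩q⊆q E _) (p∩q⊆q E _))))
                  ⊥⊆
        where
        distinct : ∀ {l l′} → E ∩ H l ≢ E ∩ H l′ → l ≢ l′
        distinct E∩Hl≢E∩Hl′ refl = E∩Hl≢E∩Hl′ refl

proposition3p7 : {d : ℕ} (n : ℕ) (M : PreMatroid d) →
    IsQuasiPaving n M → MatroidRank M n →
    ∃[ N ] (IsPaving N n × IsTame N n × ExtSeq n N M)
proposition3p7 n M (isMatroid , 0<n , ground≡⊤ , k , H , threewise , circuit⇔) rank =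
  let open QuasiPavingMatroid n H threewise M isMatroid ground≡⊤ rank circuit⇔
      (B , basisB)                = IsMatroid.basis-exists isMatroid
      (E , B⊆E , free , attached) = maximal-Type1-free (⊃-wellFounded B)
                                                       (independent⇒Type1Free (basis⇒independent basisB))
      open Paving basisB B⊆E free 0<n
  in  restriction M E , restriction-isPaving , restriction-isTame ,
      extension-sequence basisB (⊃-wellFounded E) B⊆E attached
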